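{- Let $L$ be a finite graded lattice which is isomorphic to the core of some upho lattice. Let $x\in L\setminus\{\hat0,\hat1\}$ and let $y_1,\ldots,y_k$ be the elements of $L$ covering $x$. Then there is a rank-preserving embedding of the interval $[x,y_1\vee\cdots\vee y_k]$ into $L$, i.e., an injective map $\varphi:[x,y_1\vee\cdots\vee y_k]\to L$ with $a\le b\iff\varphi(a)\le\varphi(b)$ and $\rho(\varphi(a))=\rho(a)-\rho(x)$ for all $a,b$ (so $x\mapsto\hat0$ and each $y_i$ maps to an atom).
   Context: A poset $\mathcal{P}$ is finite type $\mathbb{N}$-graded if it has a minimum $\hat0$, a rank function $\rho$ with $\rho(\hat0)=0$ such that every maximal chain has the form $\hat0=x_0\lessdot x_1\lessdot\cdots$ with $\rho(x_i)=i$, and finitely many elements of each rank. An upho lattice is a finite type $\mathbb{N}$-graded lattice $\mathcal{L}$ with at least two elements such that every principal filter $\{q\ge p\}$ is isomorphic to $\mathcal{L}$. Its core is $[\hat0,s_1\vee\cdots\vee s_r]$ with $s_i$ the atoms of $\mathcal{L}$. -}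

module Defs where

open import Data.Nat using (ℕ; zero; suc; _+_; _<_)
open import Data.Product using (Σ; ∃; _×_; _,_)
open import Data.List using (List)
open import Data.Empty using (⊥)
open import Data.List.Membership.Propositional using (_∈_)
open import Relation.Binary.PropositionalEquality using (_≡_; _≢_)
open import Relation.Binary.Lattice.Structures using (IsLattice)
open import Function.Bundles using (_⇔_)

module OrderNotions {A : Set} (_≤_ : A → A → Set) where

  _≺_ : A → A → Set
  a ≺ b = (a ≤ b) × (a ≢ b)

  _⋖_ : A → A → Set
  a ⋖ b = (a ≺ b) × (∀ c → a ≺ c → c ≺ b → ⊥)

  record FilterIso (p : A) : Set where
    field
      f        : A → A
      f-into   : ∀ a → p ≤ f a
      f-inj    : ∀ a b → f a ≡ f b → a ≡ b
      f-onto   : ∀ q → p ≤ q → ∃ λ a → f a ≡ q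
      f-order  : ∀ a b → (a ≤ b) ⇔ (f a ≤ f b)

-- Finite type ℕ-graded is expressed via a rank function ρ with ρ(0̂) = 0,
-- ρ increasing by exactly one along covers, strictly monotone, and
-- finitely many elements of each rank.
record UphoLattice : Set₁ where
  field
    Carrier   : Set
    _≤_       : Carrier → Carrier → Set
    _∨_       : Carrier → Carrier → Carrier
    _∧_       : Carrier → Carrier → Carrier
    isLattice : IsLattice _≡_ _≤_ _∨_ _∧_

  open OrderNotions _≤_ public

  field
    0̂          : Carrier
    0̂-min      : ∀ a → 0̂ ≤ a
    ρ          : Carrier → ℕ
    ρ-0̂        : ρ 0̂ ≡ 0
    ρ-cover    : ∀ {a b} → a ⋖ b → ρ b ≡ suc (ρ a)
    ρ-strict   : ∀ {a b} → a ≺ b → ρ a < ρ b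
    finiteRank : ∀ n → Σ (List Carrier) λ xs → ∀ a → ρ a ≡ n → a ∈ xs
    twoElems   : Σ Carrier λ a → a ≢ 0̂
    upho       : ∀ p → FilterIso p

  Atom : Carrier → Set
  Atom a = 0̂ ⋖ a

  -- t is the join s₁ ∨ ⋯ ∨ sᵣ of all atoms (least upper bound of the atoms);
  -- the core is then the interval [0̂, t].
  IsJoinOfAtoms : Carrier → Set
  IsJoinOfAtoms t = (∀ s → Atom s → s ≤ t)
                  × (∀ u → (∀ s → Atom s → s ≤ u) → t ≤ u)

  IsJoinOfCoversInCore : Carrier → Carrier → Carrier → Set
  IsJoinOfCoversInCore t x z =
      (z ≤ t)
    × (∀ y → y ≤ t → x ⋖ y → y ≤ z)
    × (∀ u → u ≤ t → (∀ y → y ≤ t → x ⋖ y → y ≤ u) → z ≤ u)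

  -- A rank-preserving embedding of the interval [x, z] into the core [0̂, t]:
  -- φ maps [x,z] into [0̂,t], is injective, an order embedding, and
  -- ρ(φ a) = ρ a - ρ x (written ρ(φ a) + ρ x = ρ a).
  record RankEmbedding (t x z : Carrier) : Set where
    field
      φ       : Carrier → Carrier
      φ-into  : ∀ a → x ≤ a → a ≤ z → φ a ≤ t
      φ-inj   : ∀ a b → x ≤ a → a ≤ z → x ≤ b → b ≤ z → φ a ≡ φ b → a ≡ b
      φ-order : ∀ a b → x ≤ a → a ≤ z → x ≤ b → b ≤ z → (a ≤ b) ⇔ (φ a ≤ φ b)
      φ-rank  : ∀ a → x ≤ a → a ≤ z → ρ (φ a) + ρ x ≡ ρ a

{-# OPTIONS --safe #-}
module Submission where

-- The upho property at x gives an order isomorphism f from L onto the filter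
-- above x, sending 0̂ to x and covers to covers, hence shifting ranks by ρ x.
-- Its inverse is the embedding.  It lands in the core [0̂, t]: each y covering x
-- comes from an atom f⁻¹ y ≤ t, so y ≤ f t, hence z ≤ f t and f⁻¹ z ≤ t.
--
-- Rank computations use a cover below every c ≢ 0̂, which exists only
-- classically; they are carried out in the double-negation monad and
-- escape it because equality of natural numbers is decidable.

open import Defs
open import Data.Nat as ℕ using (zero; suc; _+_)
open import Data.Nat.Properties using (<⇒≱; n≮0; +-suc; +-monoʳ-≤; m≤m+n; suc-injective; 0≢1+n; module ≤-Reasoning)
open import Data.Product using (∃; _×_; _,_; proj₁; proj₂)
open import Data.Empty using (⊥)
open import Effect.Monad using (RawMonad)
open import Level using (0ℓ)
open import Function.Base using (_∘_)
open import Function.Bundles using (_⇔_; Equivalence)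
import Function.Properties.Equivalence as ⇔
open import Relation.Binary.Lattice.Bundles using (Lattice)
open import Relation.Binary.Lattice.Structures using (IsLattice)
open import Relation.Binary.PropositionalEquality using (_≡_; _≢_; refl; sym; trans; cong; subst; subst₂)
open import Relation.Nullary.Decidable using (yes; no; decidable-stable; ¬¬-excluded-middle)
open import Relation.Nullary.Negation using (¬_; ¬¬-Monad)

open RawMonad (¬¬-Monad {0ℓ}) using (_>>=_; pure)
open Equivalence using (to; from)

module UphoLatticeProperties (U : UphoLattice) where
  open UphoLattice U
  open IsLattice isLattice renaming (refl to ≤-refl; trans to ≤-trans)

  lattice : Lattice _ _ _
  lattice = record { isLattice = isLattice }

  open import Relation.Binary.Lattice.Properties.JoinSemilattice (Lattice.joinSemilattice lattice)
    using (x≤y⇒x∨y≈y)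

  0̂≺ : ∀ {c} → c ≢ 0̂ → 0̂ ≺ c
  0̂≺ c≢0̂ = 0̂-min _ , c≢0̂ ∘ sym

  ρ-positive : ∀ {c} → c ≢ 0̂ → 0 ℕ.< ρ c
  ρ-positive {c} c≢0̂ = subst (ℕ._< ρ c) ρ-0̂ (ρ-strict (0̂≺ c≢0̂))

  ¬¬-∃⋖-above : ∀ m {d c} → d ≺ c → ρ c ℕ.≤ m + ρ d → ¬ ¬ ∃ (_⋖ c)
  ¬¬-∃⋖-above zero    d≺c ρc≤ρd _ = <⇒≱ (ρ-strict d≺c) ρc≤ρd
  ¬¬-∃⋖-above (suc m) {d} {c} d≺c ρc≤ = ¬¬-excluded-middle {A = ∃ λ e → d ≺ e × e ≺ c} >>= λ where
      (yes (e , d≺e , e≺c)) → ¬¬-∃⋖-above m e≺c (ρc≤m+ρe d≺e)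
      (no nothing-between)  → pure (d , d≺c , λ e d≺e e≺c → nothing-between (e , d≺e , e≺c))
    where
    open ≤-Reasoning
    ρc≤m+ρe : ∀ {e} → d ≺ e → ρ c ℕ.≤ m + ρ e
    ρc≤m+ρe {e} d≺e = begin
      ρ c            ≤⟨ ρc≤ ⟩
      suc m + ρ d    ≡⟨ sym (+-suc m (ρ d)) ⟩
      m + suc (ρ d)  ≤⟨ +-monoʳ-≤ m (ρ-strict d≺e) ⟩
      m + ρ e        ∎

  ¬¬-∃⋖ : ∀ {c} → c ≢ 0̂ → ¬ ¬ ∃ (_⋖ c)
  ¬¬-∃⋖ {c} c≢0̂ = ¬¬-∃⋖-above (ρ c) (0̂≺ c≢0̂) (m≤m+n (ρ c) (ρ 0̂))

  ρ-⋖-homomorphism : (g : Carrier → Carrier) → (∀ {a b} → a ⋖ b → g a ⋖ g b) →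
                     ∀ c → ρ (g c) ≡ ρ c + ρ (g 0̂)
  ρ-⋖-homomorphism g g-⋖ c = decidable-stable (_ ℕ.≟ _) (¬¬-ρ-g (ρ c) refl)
    where
    ¬¬-ρ-g : ∀ n {c} → ρ c ≡ n → ¬ ¬ (ρ (g c) ≡ n + ρ (g 0̂))
    ¬¬-ρ-g zero    ρc≡0 c≢0̂ = n≮0 (subst (0 ℕ.<_) ρc≡0 (ρ-positive (c≢0̂ ∘ cong (ρ ∘ g))))
    ¬¬-ρ-g (suc n) {c} ρc≡1+n = ¬¬-∃⋖ c≢0̂ >>= λ where
        (d , d⋖c) → ¬¬-ρ-g n (suc-injective (trans (sym (ρ-cover d⋖c)) ρc≡1+n)) >>= λ ρgd≡ →
          pure (trans (ρ-cover (g-⋖ d⋖c)) (cong suc ρgd≡))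
      where
      c≢0̂ : c ≢ 0̂
      c≢0̂ refl = 0≢1+n (trans (sym ρ-0̂) ρc≡1+n)

  module FilterIsoProperties {p} (F : FilterIso p) where
    open FilterIso F

    f-0̂ : f 0̂ ≡ p
    f-0̂ with f-onto p ≤-refl
    ... | a , fa≡p = antisym (subst (f 0̂ ≤_) fa≡p (to (f-order 0̂ a) (0̂-min a))) (f-into 0̂)

    f-≺ : ∀ {a b} → a ≺ b → f a ≺ f b
    f-≺ {a} {b} (a≤b , a≢b) = to (f-order a b) a≤b , a≢b ∘ f-inj a b

    f-≺⁻ : ∀ {a b} → f a ≺ f b → a ≺ b
    f-≺⁻ {a} {b} (fa≤fb , fa≢fb) = from (f-order a b) fa≤fb , fa≢fb ∘ cong f

    f-⋖ : ∀ {a b} → a ⋖ b → f a ⋖ f b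
    f-⋖ {a} {b} (a≺b , nothing-between) = f-≺ a≺b , between
      where
      between : ∀ e → f a ≺ e → e ≺ f b → ⊥
      between e fa≺e e≺fb with f-onto e (≤-trans (f-into a) (proj₁ fa≺e))
      ... | e′ , refl = nothing-between e′ (f-≺⁻ fa≺e) (f-≺⁻ e≺fb)

    f-⋖⁻ : ∀ {a b} → f a ⋖ f b → a ⋖ b
    f-⋖⁻ (fa≺fb , nothing-between) =
      f-≺⁻ fa≺fb , λ e a≺e e≺b → nothing-between (f e) (f-≺ a≺e) (f-≺ e≺b)

    ρ-f : ∀ c → ρ (f c) ≡ ρ c + ρ p
    ρ-f c = trans (ρ-⋖-homomorphism f f-⋖ c) (cong (λ q → ρ c + ρ q) f-0̂)

    -- Inverting p ∨ a instead of a makes f⁻¹ total without deciding p ≤ a.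
    f⁻¹ : Carrier → Carrier
    f⁻¹ a = proj₁ (f-onto (p ∨ a) (x≤x∨y p a))

    f∘f⁻¹ : ∀ {a} → p ≤ a → f (f⁻¹ a) ≡ a
    f∘f⁻¹ {a} p≤a = trans (proj₂ (f-onto (p ∨ a) (x≤x∨y p a))) (x≤y⇒x∨y≈y p≤a)

    f⁻¹-injective : ∀ {a b} → p ≤ a → p ≤ b → f⁻¹ a ≡ f⁻¹ b → a ≡ b
    f⁻¹-injective p≤a p≤b eq = trans (sym (f∘f⁻¹ p≤a)) (trans (cong f eq) (f∘f⁻¹ p≤b))

    f⁻¹-order : ∀ {a b} → p ≤ a → p ≤ b → (a ≤ b) ⇔ (f⁻¹ a ≤ f⁻¹ b)
    f⁻¹-order {a} {b} p≤a p≤b = subst₂ (λ u v → (u ≤ v) ⇔ (f⁻¹ a ≤ f⁻¹ b))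
      (f∘f⁻¹ p≤a) (f∘f⁻¹ p≤b) (⇔.sym (f-order (f⁻¹ a) (f⁻¹ b)))

    f⁻¹-adjoint : ∀ {a b} → p ≤ a → (f⁻¹ a ≤ b) ⇔ (a ≤ f b)
    f⁻¹-adjoint {a} {b} p≤a = subst (λ u → (f⁻¹ a ≤ b) ⇔ (u ≤ f b)) (f∘f⁻¹ p≤a) (f-order (f⁻¹ a) b)

    f⁻¹-atom : ∀ {y} → p ⋖ y → Atom (f⁻¹ y)
    f⁻¹-atom p⋖y = f-⋖⁻ (subst₂ _⋖_ (sym f-0̂) (sym (f∘f⁻¹ (proj₁ (proj₁ p⋖y)))) p⋖y)

    ρ-f⁻¹ : ∀ {a} → p ≤ a → ρ (f⁻¹ a) + ρ p ≡ ρ a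
    ρ-f⁻¹ {a} p≤a = trans (sym (ρ-f (f⁻¹ a))) (cong ρ (f∘f⁻¹ p≤a))

  joinOfCovers≤f[atomBound] : ∀ {t x z} → (∀ s → Atom s → s ≤ t) →
                              IsJoinOfCoversInCore t x z → z ≤ FilterIso.f (upho x) t
  joinOfCovers≤f[atomBound] {t} {x} atoms≤t (_ , _ , z-least) =
    ≤-trans (z-least (f t ∧ t) (x∧y≤y (f t) t) covers≤) (x∧y≤x (f t) t)
    where
    open FilterIso (upho x) using (f)
    open FilterIsoProperties (upho x)
    covers≤ : ∀ y → y ≤ t → x ⋖ y → y ≤ (f t ∧ t)
    covers≤ y y≤t x⋖y = ∧-greatest
      (to (f⁻¹-adjoint (proj₁ (proj₁ x⋖y))) (atoms≤t (f⁻¹ y) (f⁻¹-atom x⋖y))) y≤t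

lemma5p11 : (U : UphoLattice) → let open UphoLattice U in
    ∀ t → IsJoinOfAtoms t →
    ∀ x → x ≤ t → x ≢ 0̂ → x ≢ t →
    ∀ z → IsJoinOfCoversInCore t x z →
    RankEmbedding t x z
lemma5p11 U t (atoms≤t , _) x _ _ _ z z-join = record
  { φ       = f⁻¹
  ; φ-into  = λ a x≤a a≤z → from (f⁻¹-adjoint x≤a) (≤-trans a≤z (joinOfCovers≤f[atomBound] atoms≤t z-join))
  ; φ-inj   = λ a b x≤a _ x≤b _ → f⁻¹-injective x≤a x≤b
  ; φ-order = λ a b x≤a _ x≤b _ → f⁻¹-order x≤a x≤b
  ; φ-rank  = λ a x≤a _ → ρ-f⁻¹ x≤a
  }
  where
  open UphoLattice U using (isLattice; upho)
  open IsLattice isLattice renaming (trans to ≤-trans)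
  open UphoLatticeProperties U
  open FilterIsoProperties (upho x)
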